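{- Let $R$ be a commutative ring and $n\ge1$, $m\ge2$. The set $\{e_\alpha : \alpha\in\mathbb{N}^{(\mathcal M_m^+)},\ |\alpha|\le n\}$ is an $R$-basis of $A_R(n,m)^{S_n}$. Moreover, for every $a\in\mathbb{N}^m$, the set $\{e_\alpha : |\alpha|\le n,\ \partial(e_\alpha)=a\}$ is an $R$-basis of $A_R(n,m,a)^{S_n}$.
   Context: $A_R(n,m)=R[x_i(j):1\le i\le m,1\le j\le n]$ with $S_n$ acting by $\sigma(x_i(j))=x_i(\sigma(j))$; $A_R(m)=R[y_1,\dots,y_m]$; for $f\in A_R(m)$, $f(j):=f(x_1(j),\dots,x_m(j))$. Multidegree $\partial$ on $A_R(n,m)$ with values in $\mathbb{N}^m$: $\partial(x_i(j))$ is the $i$-th unit vector (the multidegree of $y_i$); $A_R(n,m,a)$ is the $R$-span of monomials of multidegree $a$. $\mathcal M_m^+$ is the set of monomials in $y_1,\dots,y_m$ of positive degree, and $\mathbb{N}^{(\mathcal M_m^+)}$ the set of finitely supported functions $\alpha:\mathcal M_m^+\to\mathbb{N}$, with $|\alpha|=\sum_\mu\alpha(\mu)$. For $|\alpha|\le n$, $e_\alpha\in A_R(n,m)^{S_n}$ is the coefficient of $\prod_\mu t_\mu^{\alpha(\mu)}$ in $\prod_{i=1}^n\bigl(1+\sum_{\mu\in\mathcal M_m^+}t_\mu\mu(i)\bigr)$ (commuting indeterminates $t_\mu$); in particular $e_0=1$. One has $\partial(e_\alpha)=\sum_\mu\alpha(\mu)\partial(\mu)$. -}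

module Defs where

open import Level using (Level; _⊔_)
open import Algebra.Bundles using (CommutativeRing)
open import Data.Bool using (if_then_else_)
open import Data.Nat as ℕ using (ℕ; zero; suc; _≤_; _<_)
import Data.Nat.Properties as ℕP
open import Data.Fin as Fin using (Fin)
import Data.Fin.Properties as FinP
open import Data.Vec as Vec using (Vec)
import Data.Vec.Properties as VecP
open import Data.List as List using (List; []; _∷_; _++_)
open import Data.List.Relation.Unary.All using (All)
open import Data.List.Relation.Unary.AllPairs using (AllPairs)
open import Data.List.Relation.Binary.Permutation.Propositional using (_↭_)
open import Data.Product using (_×_; _,_; proj₁; proj₂; Σ; ∃)
open import Data.Fin.Permutation using (Permutation′; _⟨$⟩ˡ_)
open import Relation.Nullary using (¬_; does)
open import Relation.Binary.PropositionalEquality using (_≡_)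
open import Relation.Binary.Definitions using (DecidableEquality)

-- Generic "formal sums": lists of (coefficient, exponent vector) pairs.
-- A list represents the sum of its terms; equality is by coefficients.

module Terms {a} (A : Set a) (k : ℕ) where
  TMon : Set
  TMon = Vec ℕ k

  Sum : Set a
  Sum = List (A × TMon)

-- y-monomials of A_R(m) = R[y_1..y_m]: exponent vectors; multidegree = itself.
YMon : ℕ → Set
YMon m = Vec ℕ m

_≟Y_ : ∀ {m} → DecidableEquality (YMon m)
_≟Y_ = VecP.≡-dec ℕP._≟_

Positive : ∀ {m} → YMon m → Set
Positive μ = 0 < Vec.sum μ

-- α ∈ ℕ^(𝓜_m^+) is represented as a finite multiset (list up to ↭) of
-- elements of 𝓜_m^+ : α(μ) = number of occurrences of μ; |α| = length.
YMulti : ℕ → Set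
YMulti m = List (YMon m)

mult : ∀ {m} → YMulti m → YMon m → ℕ
mult α μ = List.length (List.filter (_≟Y μ) α)

-- Σ_μ α(μ) ∂(μ)  ( = ∂(e_α) )
∂α : ∀ {m} → YMulti m → Vec ℕ m
∂α {m} α = List.foldr (Vec.zipWith ℕ._+_) (Vec.replicate m 0) α

module Poly {c ℓ} (R : CommutativeRing c ℓ) (n m : ℕ) where
  open CommutativeRing R

  -- monomials in x_i(j): exponent matrix  (row i, column j)
  Mon : Set
  Mon = Vec (Vec ℕ n) m

  _≟M_ : DecidableEquality Mon
  _≟M_ = VecP.≡-dec (VecP.≡-dec ℕP._≟_)

  unitM : Mon
  unitM = Vec.replicate m (Vec.replicate n 0)

  _·M_ : Mon → Mon → Mon
  _·M_ = Vec.zipWith (Vec.zipWith ℕ._+_)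

  A : Set c
  A = List (Carrier × Mon)

  coeff : A → Mon → Carrier
  coeff p u = List.foldr (λ t acc → (if does (proj₂ t ≟M u) then proj₁ t else 0#) + acc) 0# p

  _≈ₚ_ : A → A → Set ℓ
  p ≈ₚ q = ∀ u → coeff p u ≈ coeff q u

  0ₚ 1ₚ : A
  0ₚ = []
  1ₚ = (1# , unitM) ∷ []

  _⊕_ : A → A → A
  _⊕_ = _++_

  _⊗_ : A → A → A
  p ⊗ q = List.concatMap (λ s → List.map (λ t → (proj₁ s * proj₁ t , proj₂ s ·M proj₂ t)) q) p

  _•_ : Carrier → A → A
  r • p = List.map (λ t → (r * proj₁ t , proj₂ t)) p

  -- S_n action: σ(x_i(j)) = x_i(σ j); exponent of x_i(k) in σ·u is that of x_i(σ⁻¹ k) in u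
  actM : Permutation′ n → Mon → Mon
  actM σ u = Vec.map (λ row → Vec.tabulate (λ k → Vec.lookup row (σ ⟨$⟩ˡ k))) u

  act : Permutation′ n → A → A
  act σ p = List.map (λ t → (proj₁ t , actM σ (proj₂ t))) p

  Invariant : A → Set ℓ
  Invariant p = ∀ (σ : Permutation′ n) → act σ p ≈ₚ p

  -- multidegree of a monomial: ∂(x_i(j)) = i-th unit vector
  ∂M : Mon → Vec ℕ m
  ∂M u = Vec.map Vec.sum u

  InDegree : Vec ℕ m → A → Set ℓ
  InDegree a p = ∀ u → ¬ (∂M u ≡ a) → coeff p u ≈ 0#

  -- f(j) := f(x_1(j),...,x_m(j)) for a y-monomial f = μ
  evalY : Fin n → YMon m → A
  evalY j μ = (1# , Vec.tabulate (λ i → Vec.tabulate (λ k →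
                 if does (k Fin.≟ j) then Vec.lookup μ i else 0))) ∷ []

  -- e_α: coefficient of ∏_μ t_μ^{α(μ)} in ∏_{i} (1 + Σ_μ t_μ μ(i)),
  -- computed in A_R(n,m)[t_μ : μ ∈ supp α] (t_μ for μ ∉ supp α
  -- do not affect this coefficient).
  module _ (α : YMulti m) where
    supp : List (YMon m)
    supp = List.deduplicate _≟Y_ α

    k : ℕ
    k = List.length supp

    suppV : Vec (YMon m) k
    suppV = Vec.fromList supp

    open Terms A k

    _⊗T_ : Sum → Sum → Sum
    P ⊗T Q = List.concatMap (λ s → List.map (λ t → (proj₁ s ⊗ proj₁ t ,
               Vec.zipWith ℕ._+_ (proj₂ s) (proj₂ t))) Q) P

    unitT : TMon
    unitT = Vec.replicate k 0

    tvar : Fin k → TMon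
    tvar s = Vec.tabulate (λ s' → if does (s' Fin.≟ s) then 1 else 0)

    factor : Fin n → Sum
    factor i = (1ₚ , unitT) ∷ List.map (λ s → (evalY i (Vec.lookup suppV s) , tvar s)) (List.allFin k)

    generating : Sum
    generating = List.foldr (λ i acc → factor i ⊗T acc) ((1ₚ , unitT) ∷ []) (List.allFin n)

    target : TMon
    target = Vec.map (mult α) suppV

    coeffT : Sum → TMon → A
    coeffT P w = List.concatMap (λ t → if does (VecP.≡-dec ℕP._≟_ (proj₂ t) w) then proj₁ t else 0ₚ) P

    e : A
    e = coeffT generating target

  comb : List (Carrier × YMulti m) → A
  comb cs = List.foldr (λ t acc → (proj₁ t • e (proj₂ t)) ⊕ acc) 0ₚ cs

  record IsBasis {p q} (P : A → Set p) (I : YMulti m → Set q) : Set (c ⊔ ℓ ⊔ p ⊔ q) where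
    field
      members     : ∀ α → I α → P (e α)
      independent : ∀ (cs : List (Carrier × YMulti m)) →
                    All (λ t → I (proj₂ t)) cs →
                    AllPairs (λ s t → ¬ (proj₂ s ↭ proj₂ t)) cs →
                    comb cs ≈ₚ 0ₚ → All (λ t → proj₁ t ≈ 0#) cs
      spanning    : ∀ f → P f → Σ (List (Carrier × YMulti m)) (λ cs →
                    All (λ t → I (proj₂ t)) cs × (f ≈ₚ comb cs))

Admissible : ∀ {m} → ℕ → YMulti m → Set
Admissible n α = All Positive α × List.length α ≤ n

-- Write a monomial u of A_R(n,m) as ∏_j μ_j(j) with y-monomials μ_j, its columns. S_n permutes
-- the columns, so the orbit of u is determined by the multiset columns⁺ u of its nonconstant columns,
-- and every multiset α of nonconstant y-monomials with |α| ≤ n occurs. Expanding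
-- ∏_i (1 + Σ_μ t_μ μ(i)) term by term shows that the coefficient of u in e_α is 1 when columns⁺ u
-- is α and 0 otherwise: e_α is the sum over the orbit labelled α. Orbit sums of distinct orbits have
-- disjoint supports, so they are independent, and an invariant f, being constant on orbits, equals
-- Σ_α f_α e_α with f_α its coefficient at any monomial of the orbit α. Since ∂(u) = Σ columns⁺ u,
-- the same argument works in each multidegree.

module Submission where

open import Defs
open import Algebra.Bundles using (CommutativeRing)
import Algebra.Properties.CommutativeMonoid.Sum as CommutativeMonoidSum
open import Data.Bool using (true; false; if_then_else_)
open import Data.Fin as Fin using (Fin; zero; suc; punchIn)
import Data.Fin.Properties as Finₚ
open import Data.Fin.Permutation as Perm using (Permutation′; _⟨$⟩ʳ_; _⟨$⟩ˡ_; insert; insert-punchIn)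
open import Data.List as List using (List; []; _∷_; _++_; [_]; length; filter; tabulate; foldr; map; concatMap)
import Data.List.Properties as Listₚ
open import Data.List.Membership.Propositional using (_∈_; _∉_; find)
import Data.List.Membership.Propositional.Properties as ∈ₚ
import Data.List.Membership.DecPropositional as DecMembership
open import Data.List.Relation.Binary.Permutation.Propositional
  using (_↭_; ↭-refl; ↭-sym; ↭-trans; ↭-reflexive; prep; swap; ↭-isEquivalence)
open import Data.List.Relation.Binary.Permutation.Propositional.Properties
  using (↭-length; filter-↭; map⁺; shift; drop-∷; ∈-resp-↭)
open import Data.List.Relation.Unary.All as All using (All; []; _∷_)
import Data.List.Relation.Unary.All.Properties as Allₚ
open import Data.List.Relation.Unary.AllPairs using (AllPairs; []; _∷_)
import Data.List.Relation.Unary.AllPairs.Properties as AllPairsₚ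
open import Data.List.Relation.Unary.Any as Any using (here; there)
import Data.List.Relation.Unary.Any.Properties as Anyₚ
open import Data.List.Relation.Unary.Unique.Propositional using (Unique)
import Data.List.Relation.Unary.Unique.Propositional.Properties as Uniqueₚ
import Data.List.Relation.Unary.Unique.DecPropositional.Properties as UniqueDecₚ
open import Data.List.Relation.Unary.Unique.DecSetoid.Properties using (deduplicate-!)
open import Data.Maybe using (Maybe; nothing; just)
open import Data.Nat as ℕ using (ℕ; zero; suc; _≤_; _<_; s≤s; z≤n)
import Data.Nat.Properties as ℕₚ
open import Data.Nat.ListAction using (sum)
open import Data.Nat.ListAction.Properties using (sum-↭)
open import Data.Product using (_×_; _,_; proj₁; proj₂; Σ; ∃)
open import Data.Sum using (inj₁; inj₂)
open import Data.Unit using (tt)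
open import Data.Vec as Vec using (Vec; []; _∷_)
import Data.Vec.Properties as Vecₚ
open import Function using (_∘_; id; mk⇔)
open import Function.Definitions using (Injective)
open import Relation.Binary.Bundles using (DecSetoid)
open import Relation.Binary.Definitions using (Decidable; DecidableEquality)
open import Relation.Binary.PropositionalEquality as ≡ using (_≡_; _≢_; cong; cong₂; subst)
import Relation.Binary.Reasoning.Setoid as SetoidReasoning
open import Relation.Nullary using (¬_; Dec; yes; no; does; contradiction)
open import Relation.Nullary.Decidable using (_×-dec_; dec-true; dec-false; does-⇔)
open import Relation.Unary as U using (Pred)

tabulate-pick : ∀ {a} {X : Set a} {N} (g : Fin (suc N) → X) (i : Fin (suc N)) →
                tabulate g ↭ g i ∷ tabulate (g ∘ punchIn i)
tabulate-pick g zero = ↭-refl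
tabulate-pick {N = suc N} g (suc i) =
  ↭-trans (prep (g zero) (tabulate-pick (g ∘ suc) i)) (swap (g zero) (g (suc i)) ↭-refl)

tabulate-↭⇒permutation : ∀ {a} {X : Set a} N (g h : Fin N → X) → tabulate g ↭ tabulate h →
                         ∃ λ (π : Permutation′ N) → ∀ j → g (π ⟨$⟩ʳ j) ≡ h j
tabulate-↭⇒permutation zero g h _ = Perm.id , λ ()
tabulate-↭⇒permutation (suc N) g h g↭h with ∈ₚ.∈-tabulate⁻ (∈-resp-↭ (↭-sym g↭h) (here ≡.refl))
... | i , h0≡gi with tabulate-↭⇒permutation N (g ∘ punchIn i) (h ∘ suc)
       (drop-∷ (↭-trans (↭-sym (tabulate-pick g i))
                        (↭-trans g↭h (↭-reflexive (cong (_∷ tabulate (h ∘ suc)) h0≡gi)))))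
... | π , gπ≗h = insert zero i π , λ where
      zero → ≡.sym h0≡gi
      (suc j) → ≡.trans (cong g (insert-punchIn zero i π j)) (gπ≗h j)

module Multiplicity {a} {X : Set a} (_≟_ : DecidableEquality X) where
  open DecMembership _≟_ using (_∈?_)
  open import Data.Nat.Base using (_+_)
  open ≡ using (refl; sym; trans)
  open ≡.≡-Reasoning
  module ℕSum = CommutativeMonoidSum ℕₚ.+-0-commutativeMonoid

  count : List X → X → ℕ
  count xs x = length (filter (_≟ x) xs)

  count-++ : ∀ xs ys x → count (xs ++ ys) x ≡ count xs x + count ys x
  count-++ xs ys x = trans (cong length (Listₚ.filter-++ (_≟ x) xs ys)) (Listₚ.length-++ (filter (_≟ x) xs))

  count-∷ : ∀ y xs x → count (y ∷ xs) x ≡ count [ y ] x + count xs x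
  count-∷ y = count-++ [ y ]

  count-∷-self : ∀ x xs → count (x ∷ xs) x ≡ suc (count xs x)
  count-∷-self x xs with x ≟ x
  ... | yes _ = refl
  ... | no x≢x = contradiction refl x≢x

  count-[]-≢ : ∀ {x y} → y ≢ x → count [ y ] x ≡ 0
  count-[]-≢ {x} {y} y≢x with y ≟ x
  ... | yes y≡x = contradiction y≡x y≢x
  ... | no _ = refl

  count-∉ : ∀ {xs x} → x ∉ xs → count xs x ≡ 0
  count-∉ {xs} {x} x∉xs =
    cong length (Listₚ.filter-none (_≟ x) (All.tabulate λ y∈xs y≡x → x∉xs (subst (_∈ xs) y≡x y∈xs)))

  count>0⇒∈ : ∀ xs {x} → 0 < count xs x → x ∈ xs
  count>0⇒∈ (y ∷ xs) {x} positive with y ≟ x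
  ... | yes refl = here refl
  ... | no _ = there (count>0⇒∈ xs positive)

  count-filter : ∀ {p} {P : Pred X p} (P? : U.Decidable P) {x} → P x → ∀ xs → count (filter P? xs) x ≡ count xs x
  count-filter P? px [] = refl
  count-filter {P = P} P? {x} px (y ∷ xs) with P? y
  ... | yes _ = begin
    count (y ∷ filter P? xs) x              ≡⟨ count-∷ y _ x ⟩
    count [ y ] x + count (filter P? xs) x  ≡⟨ cong (count [ y ] x +_) (count-filter P? px xs) ⟩
    count [ y ] x + count xs x              ≡⟨ count-∷ y xs x ⟨
    count (y ∷ xs) x                        ∎
  ... | no ¬py = begin
    count (filter P? xs) x                  ≡⟨ count-filter P? px xs ⟩
    count xs x                              ≡⟨ cong (_+ count xs x) (count-[]-≢ λ y≡x → ¬py (subst P (sym y≡x) px)) ⟨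
    count [ y ] x + count xs x              ≡⟨ count-∷ y xs x ⟨
    count (y ∷ xs) x                        ∎

  count+length-filter : ∀ {p} {P : Pred X p} (P? : U.Decidable P) {x} → ¬ P x → (∀ {y} → ¬ P y → y ≡ x) →
                        ∀ xs → count xs x + length (filter P? xs) ≡ length xs
  count+length-filter P? ¬px only-x [] = refl
  count+length-filter {P = P} P? {x} ¬px only-x (y ∷ xs) with P? y
  ... | yes py = begin
    count (y ∷ xs) x + suc (length (filter P? xs))            ≡⟨ cong (_+ _) (count-∷ y xs x) ⟩
    count [ y ] x + count xs x + suc (length (filter P? xs))  ≡⟨ cong (λ k → k + count xs x + _) y∉ ⟩
    count xs x + suc (length (filter P? xs))                  ≡⟨ ℕₚ.+-suc _ _ ⟩
    suc (count xs x + length (filter P? xs))                  ≡⟨ cong suc (count+length-filter P? ¬px only-x xs) ⟩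
    suc (length xs)                                           ∎
    where
    y∉ : count [ y ] x ≡ 0
    y∉ = count-[]-≢ λ y≡x → ¬px (subst P y≡x py)
  ... | no ¬py with refl ← only-x ¬py = begin
    count (x ∷ xs) x + length (filter P? xs)                  ≡⟨ cong (_+ _) (count-∷-self x xs) ⟩
    suc (count xs x + length (filter P? xs))                  ≡⟨ cong suc (count+length-filter P? ¬px only-x xs) ⟩
    suc (length xs)                                           ∎

  ↭⇒count≡ : ∀ {xs ys} → xs ↭ ys → ∀ x → count xs x ≡ count ys x
  ↭⇒count≡ xs↭ys x = ↭-length (filter-↭ (_≟ x) xs↭ys)

  count≡⇒↭ : ∀ xs ys → (∀ x → count xs x ≡ count ys x) → xs ↭ ys
  count≡⇒↭ [] [] _ = ↭-refl
  count≡⇒↭ (x ∷ xs) [] same = contradiction (trans (sym (count-∷-self x xs)) (same x)) λ ()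
  count≡⇒↭ xs (y ∷ ys) same
    with ∈ₚ.∈-∃++ (count>0⇒∈ xs (subst (0 <_) (sym (trans (same y) (count-∷-self y ys))) (s≤s z≤n)))
  ... | as , bs , refl = ↭-trans (shift y as bs) (prep y (count≡⇒↭ (as ++ bs) ys λ x →
          ℕₚ.+-cancelˡ-≡ (count [ y ] x) _ _
            (begin
              count [ y ] x + count (as ++ bs) x ≡⟨ count-∷ y (as ++ bs) x ⟨
              count (y ∷ as ++ bs) x              ≡⟨ ↭⇒count≡ (shift y as bs) x ⟨
              count (as ++ y ∷ bs) x              ≡⟨ same x ⟩
              count (y ∷ ys) x                    ≡⟨ count-∷ y ys x ⟩
              count [ y ] x + count ys x          ∎)))

  _↭?_ : Decidable (_↭_ {A = X})
  [] ↭? [] = yes ↭-refl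
  [] ↭? (y ∷ ys) = no λ []↭ → contradiction (↭-length []↭) λ ()
  (x ∷ xs) ↭? ys with x ∈? ys
  ... | no x∉ys = no λ x∷xs↭ys → x∉ys (∈-resp-↭ x∷xs↭ys (here refl))
  ... | yes x∈ys with ∈ₚ.∈-∃++ x∈ys
  ... | as , bs , refl with xs ↭? (as ++ bs)
  ...   | yes xs↭ = yes (↭-trans (prep x xs↭) (↭-sym (shift x as bs)))
  ...   | no xs↭̸ = no λ x∷xs↭ → xs↭̸ (drop-∷ (↭-trans x∷xs↭ (shift x as bs)))

  ↭-decSetoid : DecSetoid a a
  ↭-decSetoid = record { isDecEquivalence = record { isEquivalence = ↭-isEquivalence ; _≟_ = _↭?_ } }

  count-tabulate : ∀ {N} (g : Fin N → X) x → count (tabulate g) x ≡ ℕSum.sum (λ j → count [ g j ] x)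
  count-tabulate {zero} g x = refl
  count-tabulate {suc N} g x = trans (count-∷ (g zero) _ x) (cong (count [ g zero ] x +_) (count-tabulate (g ∘ suc) x))

  tabulate-permute : ∀ {N} (g : Fin N → X) (π : Permutation′ N) → tabulate (g ∘ (π ⟨$⟩ʳ_)) ↭ tabulate g
  tabulate-permute g π = count≡⇒↭ _ _ λ x → trans (count-tabulate (g ∘ (π ⟨$⟩ʳ_)) x)
    (trans (sym (ℕSum.sum-permute (λ j → count [ g j ] x) π)) (sym (count-tabulate g x)))

lookup-fromList : ∀ {a} {X : Set a} (xs : List X) i → Vec.lookup (Vec.fromList xs) i ≡ List.lookup xs i
lookup-fromList (x ∷ xs) zero = ≡.refl
lookup-fromList (x ∷ xs) (suc i) = lookup-fromList xs i

Unique⇒lookup-injective : ∀ {a} {X : Set a} {xs : List X} → Unique xs →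
                          ∀ {i j} → List.lookup xs i ≡ List.lookup xs j → i ≡ j
Unique⇒lookup-injective (_ ∷ _) {zero} {zero} _ = ≡.refl
Unique⇒lookup-injective (x∉xs ∷ _) {zero} {suc j} x≡xs[j] =
  contradiction x≡xs[j] (All.lookup x∉xs (∈ₚ.∈-lookup j))
Unique⇒lookup-injective (x∉xs ∷ _) {suc i} {zero} xs[i]≡x =
  contradiction (≡.sym xs[i]≡x) (All.lookup x∉xs (∈ₚ.∈-lookup i))
Unique⇒lookup-injective (_ ∷ unique) {suc i} {suc j} xs[i]≡xs[j] =
  cong suc (Unique⇒lookup-injective unique xs[i]≡xs[j])

lookup-ext : ∀ {a} {X : Set a} {N} {xs ys : Vec X N} → (∀ i → Vec.lookup xs i ≡ Vec.lookup ys i) → xs ≡ ys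
lookup-ext {xs = xs} {ys} same =
  ≡.trans (≡.sym (Vecₚ.tabulate∘lookup xs)) (≡.trans (Vecₚ.tabulate-cong same) (Vecₚ.tabulate∘lookup ys))

module Columns {c ℓ} (R : CommutativeRing c ℓ) (n m : ℕ) where
  open Poly R n m using (Mon; actM; ∂M; unitM; _·M_)

  entry : Mon → Fin m → Fin n → ℕ
  entry u i j = Vec.lookup (Vec.lookup u i) j

  column : Mon → Fin n → YMon m
  column u j = Vec.tabulate (λ i → entry u i j)

  ≡-by-columns : ∀ {u w} → (∀ j → column u j ≡ column w j) → u ≡ w
  ≡-by-columns {u} {w} same = lookup-ext λ i → lookup-ext λ j → begin
    entry u i j                    ≡⟨ Vecₚ.lookup∘tabulate (λ i → entry u i j) i ⟨
    Vec.lookup (column u j) i      ≡⟨ cong (λ v → Vec.lookup v i) (same j) ⟩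
    Vec.lookup (column w j) i      ≡⟨ Vecₚ.lookup∘tabulate (λ i → entry w i j) i ⟩
    entry w i j                    ∎
    where open ≡.≡-Reasoning

  entry-actM : ∀ σ u i j → entry (actM σ u) i j ≡ entry u i (σ ⟨$⟩ˡ j)
  entry-actM σ u i j = ≡.trans (cong (λ row → Vec.lookup row j) (Vecₚ.lookup-map i _ u)) (Vecₚ.lookup∘tabulate _ j)

  column-actM : ∀ σ u j → column (actM σ u) j ≡ column u (σ ⟨$⟩ˡ j)
  column-actM σ u j = Vecₚ.tabulate-cong λ i → entry-actM σ u i j

  actM-flip-actM : ∀ σ u → actM (Perm.flip σ) (actM σ u) ≡ u
  actM-flip-actM σ u = lookup-ext λ i → lookup-ext λ j →
    ≡.trans (entry-actM (Perm.flip σ) (actM σ u) i j)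
      (≡.trans (entry-actM σ u i (Perm.flip σ ⟨$⟩ˡ j)) (cong (entry u i) (Perm.inverseˡ σ)))

  open Multiplicity (_≟Y_ {m})

  columns : Mon → List (YMon m)
  columns u = List.tabulate (column u)

  0Y : YMon m
  0Y = Vec.replicate m 0

  positive? : (μ : YMon m) → Dec (Positive μ)
  positive? μ = 0 ℕ.<? Vec.sum μ

  ¬Positive-0Y : ¬ Positive 0Y
  ¬Positive-0Y = ℕₚ.<-irrefl (≡.sym (sum-replicate-0 m))
    where
    sum-replicate-0 : ∀ k → Vec.sum (Vec.replicate k 0) ≡ 0
    sum-replicate-0 zero = ≡.refl
    sum-replicate-0 (suc k) = sum-replicate-0 k

  ¬Positive⇒≡0Y : ∀ {μ} → ¬ Positive μ → μ ≡ 0Y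
  ¬Positive⇒≡0Y {μ} μ≯0 = sum≡0⇒≡0 μ (ℕₚ.n≤0⇒n≡0 (ℕₚ.≮⇒≥ μ≯0))
    where
    sum≡0⇒≡0 : ∀ {k} (v : Vec ℕ k) → Vec.sum v ≡ 0 → v ≡ Vec.replicate k 0
    sum≡0⇒≡0 [] _ = ≡.refl
    sum≡0⇒≡0 (zero ∷ v) sum≡0 = cong (0 ∷_) (sum≡0⇒≡0 v sum≡0)

  0Y-+ᵛ : ∀ v → Vec.zipWith ℕ._+_ 0Y v ≡ v
  0Y-+ᵛ v = ≡.trans (Vecₚ.zipWith-replicate₁ ℕ._+_ 0 v) (Vecₚ.map-id v)

  +ᵛ-0Y : ∀ v → Vec.zipWith ℕ._+_ v 0Y ≡ v
  +ᵛ-0Y v = ≡.trans (Vecₚ.zipWith-replicate₂ ℕ._+_ v 0) (≡.trans (Vecₚ.map-cong ℕₚ.+-identityʳ v) (Vecₚ.map-id v))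

  column-·M : ∀ u w j → column (u ·M w) j ≡ Vec.zipWith ℕ._+_ (column u j) (column w j)
  column-·M u w j = lookup-ext λ i → begin
    Vec.lookup (column (u ·M w) j) i
      ≡⟨ Vecₚ.lookup∘tabulate _ i ⟩
    Vec.lookup (Vec.lookup (u ·M w) i) j
      ≡⟨ cong (λ row → Vec.lookup row j) (Vecₚ.lookup-zipWith _ i u w) ⟩
    Vec.lookup (Vec.zipWith ℕ._+_ (Vec.lookup u i) (Vec.lookup w i)) j
      ≡⟨ Vecₚ.lookup-zipWith ℕ._+_ j (Vec.lookup u i) (Vec.lookup w i) ⟩
    entry u i j ℕ.+ entry w i j
      ≡⟨ cong₂ ℕ._+_ (Vecₚ.lookup∘tabulate _ i) (Vecₚ.lookup∘tabulate _ i) ⟨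
    Vec.lookup (column u j) i ℕ.+ Vec.lookup (column w j) i
      ≡⟨ Vecₚ.lookup-zipWith ℕ._+_ i (column u j) (column w j) ⟨
    Vec.lookup (Vec.zipWith ℕ._+_ (column u j) (column w j)) i
      ∎
    where open ≡.≡-Reasoning

  column-unitM : ∀ j → column unitM j ≡ 0Y
  column-unitM j = lookup-ext λ i → ≡.trans (Vecₚ.lookup∘tabulate _ i)
    (≡.trans (cong (λ row → Vec.lookup row j) (Vecₚ.lookup-replicate i _))
      (≡.trans (Vecₚ.lookup-replicate j 0) (≡.sym (Vecₚ.lookup-replicate i 0))))

  columns⁺ : Mon → List (YMon m)
  columns⁺ u = List.filter positive? (columns u)

  columns⁺-actM : ∀ σ u → columns⁺ (actM σ u) ↭ columns⁺ u
  columns⁺-actM σ u = filter-↭ positive?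
    (↭-trans (↭-reflexive (Listₚ.tabulate-cong (column-actM σ u))) (tabulate-permute (column u) (Perm.flip σ)))

  columns⁺-↭⇒columns-↭ : ∀ {v w} → columns⁺ v ↭ columns⁺ w → columns v ↭ columns w
  columns⁺-↭⇒columns-↭ {v} {w} v↭w = count≡⇒↭ _ _ λ μ → same-count μ (positive? μ)
    where
    open ≡.≡-Reasoning
    same-count : ∀ μ → Dec (Positive μ) → count (columns v) μ ≡ count (columns w) μ
    same-count μ (yes μ>0) = begin
      count (columns v) μ   ≡⟨ count-filter positive? μ>0 (columns v) ⟨
      count (columns⁺ v) μ  ≡⟨ ↭⇒count≡ v↭w μ ⟩
      count (columns⁺ w) μ  ≡⟨ count-filter positive? μ>0 (columns w) ⟩
      count (columns w) μ   ∎
    same-count μ (no μ≯0) with ≡.refl ← ¬Positive⇒≡0Y {μ} μ≯0 = ℕₚ.+-cancelʳ-≡ _ _ _ (begin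
      count (columns v) 0Y ℕ.+ length (columns⁺ v)  ≡⟨ zeros+positives (columns v) ⟩
      length (columns v)                            ≡⟨ Listₚ.length-tabulate (column v) ⟩
      n                                             ≡⟨ Listₚ.length-tabulate (column w) ⟨
      length (columns w)                            ≡⟨ zeros+positives (columns w) ⟨
      count (columns w) 0Y ℕ.+ length (columns⁺ w)  ≡⟨ cong (count (columns w) 0Y ℕ.+_) (↭-length v↭w) ⟨
      count (columns w) 0Y ℕ.+ length (columns⁺ v)  ∎)
      where
      zeros+positives : ∀ μs → count μs 0Y ℕ.+ length (List.filter positive? μs) ≡ length μs
      zeros+positives = count+length-filter positive? ¬Positive-0Y ¬Positive⇒≡0Y

  columns⁺-↭⇒orbit : ∀ {v w} → columns⁺ v ↭ columns⁺ w → ∃ λ σ → actM σ v ≡ w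
  columns⁺-↭⇒orbit {v} {w} v↭w =
    let π , vπ≗w = tabulate-↭⇒permutation n (column v) (column w) (columns⁺-↭⇒columns-↭ {v} {w} v↭w)
    in Perm.flip π , ≡-by-columns {actM (Perm.flip π) v} {w} λ j → ≡.trans (column-actM (Perm.flip π) v j) (vπ≗w j)

  ∂α-filter-positive : ∀ β → ∂α (List.filter positive? β) ≡ ∂α β
  ∂α-filter-positive [] = ≡.refl
  ∂α-filter-positive (μ ∷ β) = by-sign (positive? μ)
    where
    by-sign : Dec (Positive μ) → ∂α (List.filter positive? (μ ∷ β)) ≡ ∂α (μ ∷ β)
    by-sign (yes μ>0) = ≡.trans (cong ∂α (Listₚ.filter-accept positive? {μ} {β} μ>0))
                                (cong (Vec.zipWith ℕ._+_ μ) (∂α-filter-positive β))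
    by-sign (no μ≯0) = ≡.trans (cong ∂α (Listₚ.filter-reject positive? {μ} {β} μ≯0)) (≡.trans (∂α-filter-positive β)
      (≡.sym (≡.trans (cong (λ ν → Vec.zipWith ℕ._+_ ν (∂α β)) (¬Positive⇒≡0Y μ≯0)) (0Y-+ᵛ (∂α β)))))

  lookup-∂α-tabulate : ∀ {N} (g : Fin N → YMon m) i →
                       Vec.lookup (∂α (List.tabulate g)) i ≡ Vec.sum (Vec.tabulate λ j → Vec.lookup (g j) i)
  lookup-∂α-tabulate {zero} g i = Vecₚ.lookup-replicate i 0
  lookup-∂α-tabulate {suc N} g i =
    ≡.trans (Vecₚ.lookup-zipWith ℕ._+_ i (g zero) _) (cong (Vec.lookup (g zero) i ℕ.+_) (lookup-∂α-tabulate (g ∘ suc) i))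

  ∂M≡∂α-columns⁺ : ∀ u → ∂M u ≡ ∂α (columns⁺ u)
  ∂M≡∂α-columns⁺ u = ≡.sym (≡.trans (∂α-filter-positive (columns u)) (lookup-ext λ i → begin
    Vec.lookup (∂α (columns u)) i                              ≡⟨ lookup-∂α-tabulate (column u) i ⟩
    Vec.sum (Vec.tabulate λ j → Vec.lookup (column u j) i)
      ≡⟨ cong Vec.sum (Vecₚ.tabulate-cong λ j → Vecₚ.lookup∘tabulate (λ i → entry u i j) i) ⟩
    Vec.sum (Vec.tabulate (entry u i))                         ≡⟨ cong Vec.sum (Vecₚ.tabulate∘lookup (Vec.lookup u i)) ⟩
    Vec.sum (Vec.lookup u i)                                   ≡⟨ Vecₚ.lookup-map i Vec.sum u ⟨
    Vec.lookup (∂M u) i                                        ∎))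
    where open ≡.≡-Reasoning

  lookup-∂α : ∀ (β : YMulti m) i → Vec.lookup (∂α β) i ≡ sum (map (λ μ → Vec.lookup μ i) β)
  lookup-∂α [] i = Vecₚ.lookup-replicate i 0
  lookup-∂α (μ ∷ β) i = ≡.trans (Vecₚ.lookup-zipWith ℕ._+_ i μ (∂α β)) (cong (Vec.lookup μ i ℕ.+_) (lookup-∂α β i))

  ∂α-↭ : ∀ {β γ : YMulti m} → β ↭ γ → ∂α β ≡ ∂α γ
  ∂α-↭ {β} {γ} β↭γ = lookup-ext λ i →
    ≡.trans (lookup-∂α β i) (≡.trans (sum-↭ (map⁺ (λ μ → Vec.lookup μ i) β↭γ)) (≡.sym (lookup-∂α γ i)))

  pad : ∀ {N} → List (YMon m) → Fin N → YMon m
  pad [] _ = 0Y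
  pad (μ ∷ β) zero = μ
  pad (μ ∷ β) (suc j) = pad β j

  monomial : List (YMon m) → Mon
  monomial β = Vec.tabulate λ i → Vec.tabulate λ j → Vec.lookup (pad β j) i

  column-monomial : ∀ β j → column (monomial β) j ≡ pad β j
  column-monomial β j = lookup-ext λ i → ≡.trans (Vecₚ.lookup∘tabulate _ i)
    (≡.trans (cong (λ row → Vec.lookup row j) (Vecₚ.lookup∘tabulate _ i)) (Vecₚ.lookup∘tabulate _ j))

  filter-positive-pad : ∀ N β → All Positive β → length β ≤ N →
                        List.filter positive? (List.tabulate {n = N} (pad β)) ≡ β
  filter-positive-pad zero [] _ _ = ≡.refl
  filter-positive-pad (suc N) [] _ _ =
    ≡.trans (Listₚ.filter-reject positive? {0Y} {List.tabulate {n = N} (pad [])} ¬Positive-0Y)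
            (filter-positive-pad N [] [] z≤n)
  filter-positive-pad (suc N) (μ ∷ β) (μ>0 ∷ β>0) (s≤s |β|≤N) =
    ≡.trans (Listₚ.filter-accept positive? {μ} {List.tabulate {n = N} (pad β)} μ>0)
            (cong (μ ∷_) (filter-positive-pad N β β>0 |β|≤N))

  columns⁺-monomial : ∀ {β} → Admissible n β → columns⁺ (monomial β) ≡ β
  columns⁺-monomial {β} (β>0 , |β|≤n) =
    ≡.trans (cong (List.filter positive?) (Listₚ.tabulate-cong (column-monomial β))) (filter-positive-pad n β β>0 |β|≤n)

  columns⁺-admissible : ∀ u → Admissible n (columns⁺ u)
  columns⁺-admissible u = Allₚ.all-filter positive? (columns u) ,
    ℕₚ.≤-trans (Listₚ.length-filter positive? (columns u)) (ℕₚ.≤-reflexive (Listₚ.length-tabulate (column u)))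

module Coefficients {c ℓ} (R : CommutativeRing c ℓ) (n m : ℕ) where
  open CommutativeRing R
  open Poly R n m

  ∑ : ∀ {a} {X : Set a} → List X → (X → Carrier) → Carrier
  ∑ xs f = foldr (λ x acc → f x + acc) 0# xs

  ∑-cong : ∀ {a} {X : Set a} (xs : List X) {f g : X → Carrier} → (∀ x → f x ≈ g x) → ∑ xs f ≈ ∑ xs g
  ∑-cong [] f≈g = refl
  ∑-cong (x ∷ xs) f≈g = +-cong (f≈g x) (∑-cong xs f≈g)

  ∑-map : ∀ {a b} {X : Set a} {Y : Set b} (g : X → Y) xs (f : Y → Carrier) → ∑ (map g xs) f ≡ ∑ xs (f ∘ g)
  ∑-map g [] f = ≡.refl
  ∑-map g (x ∷ xs) f = cong (f (g x) +_) (∑-map g xs f)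

  ∑-++ : ∀ {a} {X : Set a} (xs ys : List X) f → ∑ (xs ++ ys) f ≈ ∑ xs f + ∑ ys f
  ∑-++ [] ys f = sym (+-identityˡ _)
  ∑-++ (x ∷ xs) ys f = trans (+-congˡ (∑-++ xs ys f)) (sym (+-assoc _ _ _))

  ∑-concatMap : ∀ {a b} {X : Set a} {Y : Set b} (h : X → List Y) xs f →
                ∑ (concatMap h xs) f ≈ ∑ xs (λ x → ∑ (h x) f)
  ∑-concatMap h [] f = refl
  ∑-concatMap h (x ∷ xs) f = trans (∑-++ (h x) (concatMap h xs) f) (+-congˡ (∑-concatMap h xs f))

  ∑-zero : ∀ {a} {X : Set a} {xs : List X} {f} → All (λ x → f x ≈ 0#) xs → ∑ xs f ≈ 0#
  ∑-zero [] = refl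
  ∑-zero (fx≈0 ∷ rest) = trans (+-cong fx≈0 (∑-zero rest)) (+-identityˡ 0#)

  ∑-single : ∀ {a} {X : Set a} {xs : List X} {f} {x₀} → Unique xs → x₀ ∈ xs →
             (∀ x → x ≢ x₀ → f x ≈ 0#) → ∑ xs f ≈ f x₀
  ∑-single (x₀∉xs ∷ _) (here ≡.refl) elsewhere =
    trans (+-congˡ (∑-zero (All.map (λ x₀≢x → elsewhere _ (x₀≢x ∘ ≡.sym)) x₀∉xs))) (+-identityʳ _)
  ∑-single {x₀ = x₀} (x∉xs ∷ unique) (there x₀∈xs) elsewhere =
    trans (+-cong (elsewhere _ λ x≡x₀ → All.lookup x∉xs x₀∈xs x≡x₀) (∑-single unique x₀∈xs elsewhere))
          (+-identityˡ _)

  coeff-++ : ∀ p q u → coeff (p ++ q) u ≈ coeff p u + coeff q u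
  coeff-++ [] q u = sym (+-identityˡ _)
  coeff-++ (t ∷ p) q u = trans (+-congˡ (coeff-++ p q u)) (sym (+-assoc _ _ _))

  coeff-• : ∀ r p u → coeff (r • p) u ≈ r * coeff p u
  coeff-• r [] u = sym (zeroʳ r)
  coeff-• r ((a , w) ∷ p) u with does (w ≟M u)
  ... | true = trans (+-congˡ (coeff-• r p u)) (sym (distribˡ r a _))
  ... | false = trans (+-cong (sym (zeroʳ r)) (coeff-• r p u)) (sym (distribˡ r 0# _))

  coeff-comb-∷ : ∀ r α cs u → coeff (comb ((r , α) ∷ cs)) u ≈ r * coeff (e α) u + coeff (comb cs) u
  coeff-comb-∷ r α cs u = trans (coeff-++ (r • e α) (comb cs) u) (+-congʳ (coeff-• r (e α) u))

  coeff-concatMap : ∀ {a} {X : Set a} (h : X → A) xs u → coeff (concatMap h xs) u ≈ ∑ xs (λ x → coeff (h x) u)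
  coeff-concatMap h [] u = refl
  coeff-concatMap h (x ∷ xs) u = trans (coeff-++ (h x) (concatMap h xs) u) (+-congˡ (coeff-concatMap h xs u))

  coeff-∉ : ∀ p {u} → ¬ u ∈ map proj₂ p → coeff p u ≈ 0#
  coeff-∉ [] u∉p = refl
  coeff-∉ ((a , w) ∷ p) {u} u∉p = trans
    (+-cong (reflexive (cong (if_then a else 0#) (dec-false (w ≟M u) λ w≡u → u∉p (here (≡.sym w≡u)))))
            (coeff-∉ p (u∉p ∘ there)))
    (+-identityˡ 0#)

  open Columns R n m

  coeff-act : ∀ σ p u → coeff (act σ p) u ≡ coeff p (actM (Perm.flip σ) u)
  coeff-act σ [] u = ≡.refl
  coeff-act σ ((a , w) ∷ p) u = cong₂ _+_
    (cong (if_then a else 0#) (does-⇔ (mk⇔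
      (λ σw≡u → ≡.trans (≡.sym (actM-flip-actM σ w)) (cong (actM (Perm.flip σ)) σw≡u))
      (λ w≡σ⁻¹u → ≡.trans (cong (actM σ) w≡σ⁻¹u) (actM-flip-actM (Perm.flip σ) u)))
      (actM σ w ≟M u) (w ≟M actM (Perm.flip σ) u)))
    (coeff-act σ p u)

  Invariant⇒coeff-actM : ∀ p → Invariant p → ∀ σ u → coeff p (actM σ u) ≈ coeff p u
  Invariant⇒coeff-actM p invariant σ u = trans (reflexive (≡.sym (coeff-act (Perm.flip σ) p u))) (invariant (Perm.flip σ) u)

module Expansion {c ℓ} (R : CommutativeRing c ℓ) (n m : ℕ) (α : YMulti m) where
  open CommutativeRing R hiding (zero)
  open Poly R n m
  open Coefficients R n m
  open Columns R n m
  module ≈-Reasoning = SetoidReasoning setoid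

  TMon : Set
  TMon = Vec ℕ (k α)

  -- A choice records which term of a factor 1 + Σ_s t_s μ_s(i) of the generating product is taken,
  -- μ_s running over the support of α: nothing for 1, just s for t_s μ_s(i).
  Choice : Set
  Choice = Maybe (Fin (k α))

  value : Choice → YMon m
  value nothing = 0Y
  value (just s) = Vec.lookup (suppV α) s

  oneChoices : List Choice
  oneChoices = nothing ∷ map just (List.allFin (k α))

  choices : ∀ N → List (Vec Choice N)
  choices zero = [] ∷ []
  choices (suc N) = concatMap (λ o → map (o ∷_) (choices N)) oneChoices

  chosenMon : Fin n → Choice → Mon
  chosenMon i nothing = unitM
  chosenMon i (just s) = Vec.tabulate λ i′ → Vec.tabulate λ j →
    if does (j Fin.≟ i) then Vec.lookup (Vec.lookup (suppV α) s) i′ else 0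

  entry-chosenMon : ∀ i s i′ j → Vec.lookup (column (chosenMon i (just s)) j) i′
                                  ≡ (if does (j Fin.≟ i) then Vec.lookup (Vec.lookup (suppV α) s) i′ else 0)
  entry-chosenMon i s i′ j = ≡.trans (Vecₚ.lookup∘tabulate _ i′)
    (≡.trans (cong (λ row → Vec.lookup row j) (Vecₚ.lookup∘tabulate _ i′)) (Vecₚ.lookup∘tabulate _ j))

  chosenTerm : Fin n → Choice → A × TMon
  chosenTerm i nothing = 1ₚ , unitT α
  chosenTerm i (just s) = evalY i (Vec.lookup (suppV α) s) , tvar α s

  factor≡ : ∀ i → factor α i ≡ map (chosenTerm i) oneChoices
  factor≡ i = cong ((1ₚ , unitT α) ∷_) (Listₚ.map-∘ (List.allFin (k α)))

  combine : A × TMon → A × TMon → A × TMon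
  combine s t = proj₁ s ⊗ proj₁ t , Vec.zipWith ℕ._+_ (proj₂ s) (proj₂ t)

  product : ∀ {N} → (Fin N → Fin n) → Vec Choice N → A × TMon
  product f [] = 1ₚ , unitT α
  product f (o ∷ ch) = combine (chosenTerm (f zero) o) (product (f ∘ suc) ch)

  expand-∷ : ∀ {N} (f : Fin (suc N) → Fin n) (chs : List (Vec Choice N)) os →
             concatMap (λ s → map (combine s) (map (product (f ∘ suc)) chs)) (map (chosenTerm (f zero)) os)
             ≡ map (product f) (concatMap (λ o → map (o ∷_) chs) os)
  expand-∷ f chs [] = ≡.refl
  expand-∷ f chs (o ∷ os) = ≡.trans
    (cong₂ _++_ (≡.trans (≡.sym (Listₚ.map-∘ chs)) (Listₚ.map-∘ chs)) (expand-∷ f chs os))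
    (≡.sym (Listₚ.map-++ (product f) (map (o ∷_) chs) _))

  expand : ∀ N (f : Fin N → Fin n) →
           List.foldr (λ i acc → _⊗T_ α (factor α i) acc) ((1ₚ , unitT α) ∷ []) (List.tabulate f)
           ≡ map (product f) (choices N)
  expand zero f = ≡.refl
  expand (suc N) f =
    ≡.trans (cong₂ (_⊗T_ α) (factor≡ (f zero)) (expand N (f ∘ suc))) (expand-∷ f (choices N) oneChoices)

  scalar : ∀ {N} → (Fin N → Fin n) → Vec Choice N → Carrier
  scalar f [] = 1#
  scalar f (o ∷ ch) = 1# * scalar (f ∘ suc) ch

  scalar≈1 : ∀ {N} (f : Fin N → Fin n) ch → scalar f ch ≈ 1#
  scalar≈1 f [] = refl
  scalar≈1 f (o ∷ ch) = trans (*-identityˡ _) (scalar≈1 (f ∘ suc) ch)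

  monomialOf : ∀ {N} → (Fin N → Fin n) → Vec Choice N → Mon
  monomialOf f [] = unitM
  monomialOf f (o ∷ ch) = chosenMon (f zero) o ·M monomialOf (f ∘ suc) ch

  product-single : ∀ {N} (f : Fin N → Fin n) ch → proj₁ (product f ch) ≡ (scalar f ch , monomialOf f ch) ∷ []
  product-single f [] = ≡.refl
  product-single f (nothing ∷ ch) = cong (_⊗_ 1ₚ) (product-single (f ∘ suc) ch)
  product-single f (just s ∷ ch) = cong (_⊗_ (evalY (f zero) (Vec.lookup (suppV α) s))) (product-single (f ∘ suc) ch)

  tdeg : Vec Choice n → TMon
  tdeg ch = proj₂ (product id ch)

  Hit : Mon → Vec Choice n → Set
  Hit u ch = tdeg ch ≡ target α × monomialOf id ch ≡ u

  hit? : ∀ u ch → Dec (Hit u ch)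
  hit? u ch = Vecₚ.≡-dec ℕₚ._≟_ (tdeg ch) (target α) ×-dec (monomialOf id ch ≟M u)

  indicator : ∀ {p} {P : Set p} → Dec P → Carrier
  indicator P? = if does P? then 1# else 0#

  indicator-yes : ∀ {p} {P : Set p} (P? : Dec P) → P → indicator P? ≈ 1#
  indicator-yes P? p = reflexive (cong (if_then 1# else 0#) (dec-true P? p))

  indicator-no : ∀ {p} {P : Set p} (P? : Dec P) → ¬ P → indicator P? ≈ 0#
  indicator-no P? ¬p = reflexive (cong (if_then 1# else 0#) (dec-false P? ¬p))

  coeff-selected : ∀ {p} {P : Set p} (P? : Dec P) a w u → a ≈ 1# →
                   coeff (if does P? then (a , w) ∷ [] else []) u ≈ indicator (P? ×-dec (w ≟M u))
  coeff-selected (yes _) a w u a≈1 with does (w ≟M u)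
  ... | true = trans (+-identityʳ a) a≈1
  ... | false = +-identityʳ 0#
  coeff-selected (no _) a w u _ = refl

  coeff-e : ∀ u → coeff (e α) u ≈ ∑ (choices n) (indicator ∘ hit? u)
  coeff-e u = begin
    coeff (e α) u                                     ≈⟨ coeff-concatMap select (generating α) u ⟩
    ∑ (generating α) (λ t → coeff (select t) u)       ≡⟨ cong (λ ts → ∑ ts (λ t → coeff (select t) u)) (expand n id) ⟩
    ∑ (map (product id) (choices n)) (λ t → coeff (select t) u)
                                                      ≡⟨ ∑-map (product id) (choices n) _ ⟩
    ∑ (choices n) (λ ch → coeff (select (product id ch)) u)
                                                      ≈⟨ ∑-cong (choices n) selected ⟩
    ∑ (choices n) (indicator ∘ hit? u)                ∎
    where
    open ≈-Reasoning
    select : A × TMon → A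
    select t = if does (Vecₚ.≡-dec ℕₚ._≟_ (proj₂ t) (target α)) then proj₁ t else 0ₚ

    selected : ∀ ch → coeff (select (product id ch)) u ≈ indicator (hit? u ch)
    selected ch rewrite product-single id ch =
      coeff-selected (Vecₚ.≡-dec ℕₚ._≟_ (tdeg ch) (target α)) _ _ u (scalar≈1 id ch)

  oneChoices-unique : Unique oneChoices
  oneChoices-unique = All.tabulate nothing≢ ∷ Uniqueₚ.map⁺ just-injective (Uniqueₚ.allFin⁺ (k α))
    where
    just-injective : ∀ {s s′ : Fin (k α)} → just s ≡ just s′ → s ≡ s′
    just-injective ≡.refl = ≡.refl
    nothing≢ : ∀ {o} → o ∈ map just (List.allFin (k α)) → nothing ≢ o
    nothing≢ o∈ nothing≡o with ∈ₚ.∈-map⁻ just o∈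
    ... | _ , _ , ≡.refl = contradiction nothing≡o λ ()

  oneChoices-complete : ∀ o → o ∈ oneChoices
  oneChoices-complete nothing = here ≡.refl
  oneChoices-complete (just s) = there (∈ₚ.∈-map⁺ just (∈ₚ.∈-allFin s))

  ∑-choices-single : ∀ N {f : Vec Choice N → Carrier} ch₀ → (∀ ch → ch ≢ ch₀ → f ch ≈ 0#) →
                     ∑ (choices N) f ≈ f ch₀
  ∑-choices-single zero [] _ = +-identityʳ _
  ∑-choices-single (suc N) {f} (o₀ ∷ ch₀) elsewhere = begin
    ∑ (choices (suc N)) f
      ≈⟨ ∑-concatMap (λ o → map (o ∷_) (choices N)) oneChoices f ⟩
    ∑ oneChoices (λ o → ∑ (map (o ∷_) (choices N)) f)
      ≈⟨ ∑-cong oneChoices (λ o → reflexive (∑-map (o ∷_) (choices N) f)) ⟩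
    ∑ oneChoices (λ o → ∑ (choices N) (f ∘ (o ∷_)))
      ≈⟨ ∑-cong oneChoices (λ o → ∑-choices-single N ch₀ λ ch ch≢ch₀ →
                                    elsewhere (o ∷ ch) (ch≢ch₀ ∘ Vecₚ.∷-injectiveʳ)) ⟩
    ∑ oneChoices (λ o → f (o ∷ ch₀))
      ≈⟨ ∑-single oneChoices-unique (oneChoices-complete o₀) (λ o o≢o₀ →
                                    elsewhere (o ∷ ch₀) (o≢o₀ ∘ Vecₚ.∷-injectiveˡ)) ⟩
    f (o₀ ∷ ch₀)
      ∎
    where open ≈-Reasoning

  column-chosenMon : ∀ i o → column (chosenMon i o) i ≡ value o
  column-chosenMon i nothing = column-unitM i
  column-chosenMon i (just s) = lookup-ext λ i′ → begin
    Vec.lookup (column (chosenMon i (just s)) i) i′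
      ≡⟨ entry-chosenMon i s i′ i ⟩
    (if does (i Fin.≟ i) then Vec.lookup (value (just s)) i′ else 0)
      ≡⟨ cong (if_then _ else 0) (dec-true (i Fin.≟ i) ≡.refl) ⟩
    Vec.lookup (value (just s)) i′
      ∎
    where open ≡.≡-Reasoning

  column-chosenMon-≢ : ∀ i o j → j ≢ i → column (chosenMon i o) j ≡ 0Y
  column-chosenMon-≢ i nothing j _ = column-unitM j
  column-chosenMon-≢ i (just s) j j≢i = lookup-ext λ i′ → begin
    Vec.lookup (column (chosenMon i (just s)) j) i′
      ≡⟨ entry-chosenMon i s i′ j ⟩
    (if does (j Fin.≟ i) then Vec.lookup (value (just s)) i′ else 0)
      ≡⟨ cong (if_then _ else 0) (dec-false (j Fin.≟ i) j≢i) ⟩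
    0
      ≡⟨ Vecₚ.lookup-replicate i′ 0 ⟨
    Vec.lookup 0Y i′
      ∎
    where open ≡.≡-Reasoning

  column-monomialOf-outside : ∀ {N} (f : Fin N → Fin n) ch j → (∀ t → f t ≢ j) → column (monomialOf f ch) j ≡ 0Y
  column-monomialOf-outside f [] j _ = column-unitM j
  column-monomialOf-outside f (o ∷ ch) j j∉f = begin
    column (monomialOf f (o ∷ ch)) j
      ≡⟨ column-·M (chosenMon (f zero) o) (monomialOf (f ∘ suc) ch) j ⟩
    Vec.zipWith ℕ._+_ (column (chosenMon (f zero) o) j) (column (monomialOf (f ∘ suc) ch) j)
      ≡⟨ cong₂ (Vec.zipWith ℕ._+_) (column-chosenMon-≢ (f zero) o j (j∉f zero ∘ ≡.sym))
                                   (column-monomialOf-outside (f ∘ suc) ch j (j∉f ∘ suc)) ⟩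
    Vec.zipWith ℕ._+_ 0Y 0Y
      ≡⟨ 0Y-+ᵛ 0Y ⟩
    0Y
      ∎
    where open ≡.≡-Reasoning

  column-monomialOf : ∀ {N} (f : Fin N → Fin n) → Injective _≡_ _≡_ f →
                      ∀ ch t → column (monomialOf f ch) (f t) ≡ value (Vec.lookup ch t)
  column-monomialOf f f-injective (o ∷ ch) t =
    ≡.trans (column-·M (chosenMon (f zero) o) (monomialOf (f ∘ suc) ch) (f t)) (by-index t)
    where
    f[1+t]≢f[0] : ∀ t → f (suc t) ≢ f zero
    f[1+t]≢f[0] t = Finₚ.0≢1+n ∘ ≡.sym ∘ f-injective

    by-index : ∀ t → Vec.zipWith ℕ._+_ (column (chosenMon (f zero) o) (f t)) (column (monomialOf (f ∘ suc) ch) (f t))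
                     ≡ value (Vec.lookup (o ∷ ch) t)
    by-index zero = ≡.trans
      (cong₂ (Vec.zipWith ℕ._+_) (column-chosenMon (f zero) o)
                                 (column-monomialOf-outside (f ∘ suc) ch (f zero) f[1+t]≢f[0]))
      (+ᵛ-0Y (value o))
    by-index (suc t) = ≡.trans
      (cong₂ (Vec.zipWith ℕ._+_) (column-chosenMon-≢ (f zero) o (f (suc t)) (f[1+t]≢f[0] t))
                                 (column-monomialOf (f ∘ suc) (Finₚ.suc-injective ∘ f-injective) ch t))
      (0Y-+ᵛ (value (Vec.lookup ch t)))

  module _ (α>0 : All Positive α) where
    open Multiplicity (_≟Y_ {m})
    open DecMembership (_≟Y_ {m}) using (_∈?_)

    supp-∈ : ∀ s → Vec.lookup (suppV α) s ∈ α
    supp-∈ s = ∈ₚ.∈-deduplicate⁻ _≟Y_ α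
      (≡.subst (_∈ supp α) (≡.sym (lookup-fromList (supp α) s)) (∈ₚ.∈-lookup s))

    supp-positive : ∀ s → Positive (Vec.lookup (suppV α) s)
    supp-positive s = All.lookup α>0 (supp-∈ s)

    supp-injective : Injective _≡_ _≡_ (Vec.lookup (suppV α))
    supp-injective {s} {s′} μs≡μs′ = Unique⇒lookup-injective (UniqueDecₚ.deduplicate-! _≟Y_ α)
      (≡.trans (≡.sym (lookup-fromList (supp α) s)) (≡.trans μs≡μs′ (lookup-fromList (supp α) s′)))

    ∈⇒supp-index : ∀ {ν} → ν ∈ α → ∃ λ s → Vec.lookup (suppV α) s ≡ ν
    ∈⇒supp-index ν∈α = let ν∈supp = ∈ₚ.∈-deduplicate⁺ _≟Y_ ν∈α in
      Any.index ν∈supp , ≡.trans (lookup-fromList (supp α) (Any.index ν∈supp)) (≡.sym (Anyₚ.lookup-index ν∈supp))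

    value≡supp⇒≡just : ∀ o s → value o ≡ Vec.lookup (suppV α) s → o ≡ just s
    value≡supp⇒≡just nothing s 0≡μ = contradiction (≡.subst Positive (≡.sym 0≡μ) (supp-positive s)) ¬Positive-0Y
    value≡supp⇒≡just (just s′) s μ≡μ = cong just (supp-injective μ≡μ)

    value-injective : Injective _≡_ _≡_ value
    value-injective {o} {just s} vo≡μ = value≡supp⇒≡just o s vo≡μ
    value-injective {nothing} {nothing} _ = ≡.refl
    value-injective {just s} {nothing} μ≡0 = contradiction (≡.subst Positive μ≡0 (supp-positive s)) ¬Positive-0Y

    lookup-tdeg : ∀ {N} (f : Fin N → Fin n) ch s →
                  Vec.lookup (proj₂ (product f ch)) s ≡ count (List.tabulate (value ∘ Vec.lookup ch)) (Vec.lookup (suppV α) s)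
    lookup-tdeg f [] s = Vecₚ.lookup-replicate s 0
    lookup-tdeg f (o ∷ ch) s = ≡.trans (Vecₚ.lookup-zipWith ℕ._+_ s (proj₂ (chosenTerm (f zero) o)) _)
      (≡.trans (cong₂ ℕ._+_ (lookup-chosenTerm o) (lookup-tdeg (f ∘ suc) ch s)) (≡.sym (count-∷ (value o) _ _)))
      where
      lookup-chosenTerm : ∀ o → Vec.lookup (proj₂ (chosenTerm (f zero) o)) s ≡ count List.[ value o ] (Vec.lookup (suppV α) s)
      lookup-chosenTerm nothing = ≡.trans (Vecₚ.lookup-replicate s 0)
        (≡.sym (count-[]-≢ {Vec.lookup (suppV α) s} {0Y} λ 0≡μ →
                 ¬Positive-0Y (≡.subst Positive (≡.sym 0≡μ) (supp-positive s))))
      lookup-chosenTerm (just s′) with s Fin.≟ s′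
      ... | yes ≡.refl = ≡.trans (Vecₚ.lookup∘tabulate _ s)
        (≡.trans (cong (if_then 1 else 0) (dec-true (s Fin.≟ s) ≡.refl)) (≡.sym (count-∷-self (Vec.lookup (suppV α) s) [])))
      ... | no s≢s′ = ≡.trans (Vecₚ.lookup∘tabulate _ s)
        (≡.trans (cong (if_then 1 else 0) (dec-false (s Fin.≟ s′) s≢s′))
                 (≡.sym (count-[]-≢ (s≢s′ ∘ ≡.sym ∘ supp-injective))))

    -- The only choice vector producing u takes, at each column of u, the support element equal to it;
    -- its t-degree then counts the columns of u, so it hits target α exactly when columns⁺ u ↭ α.
    Fits : Mon → Vec Choice n → Set
    Fits u ch = ∀ j → column u j ≡ value (Vec.lookup ch j)

    monomialOf≡⇒Fits : ∀ {u} ch → monomialOf id ch ≡ u → Fits u ch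
    monomialOf≡⇒Fits ch ≡.refl = column-monomialOf id id ch

    Fits⇒monomialOf≡ : ∀ {u} ch → Fits u ch → monomialOf id ch ≡ u
    Fits⇒monomialOf≡ {u} ch fits = ≡-by-columns {monomialOf id ch} {u} λ j →
      ≡.trans (column-monomialOf id id ch j) (≡.sym (fits j))

    Fits⇒count-columns⁺ : ∀ u ch → Fits u ch → ∀ s → count (columns⁺ u) (Vec.lookup (suppV α) s) ≡ Vec.lookup (tdeg ch) s
    Fits⇒count-columns⁺ u ch fits s = begin
      count (columns⁺ u) μ                                   ≡⟨ count-filter positive? (supp-positive s) (columns u) ⟩
      count (columns u) μ                                    ≡⟨ cong (λ cols → count cols μ) (Listₚ.tabulate-cong fits) ⟩
      count (List.tabulate (value ∘ Vec.lookup ch)) μ        ≡⟨ lookup-tdeg id ch s ⟨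
      Vec.lookup (tdeg ch) s                                 ∎
      where
      open ≡.≡-Reasoning
      μ : YMon m
      μ = Vec.lookup (suppV α) s

    Fits⇒columns⁺⊆α : ∀ u ch {ν} → Fits u ch → ν ∈ columns⁺ u → ν ∈ α
    Fits⇒columns⁺⊆α u ch fits ν∈ with ∈ₚ.∈-filter⁻ positive? {xs = columns u} ν∈
    ... | ν∈cols , ν>0 with ∈ₚ.∈-tabulate⁻ ν∈cols
    ... | j , ν≡col rewrite ≡.trans ν≡col (fits j) with Vec.lookup ch j
    ...   | nothing = contradiction ν>0 ¬Positive-0Y
    ...   | just s = supp-∈ s

    Fits⇒↭⇒tdeg≡target : ∀ u ch → Fits u ch → columns⁺ u ↭ α → tdeg ch ≡ target α
    Fits⇒↭⇒tdeg≡target u ch fits u↭α = lookup-ext λ s → ≡.trans (≡.sym (Fits⇒count-columns⁺ u ch fits s))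
      (≡.trans (↭⇒count≡ u↭α _) (≡.sym (Vecₚ.lookup-map s (mult α) (suppV α))))

    Fits⇒tdeg≡target⇒↭ : ∀ u ch → Fits u ch → tdeg ch ≡ target α → columns⁺ u ↭ α
    Fits⇒tdeg≡target⇒↭ u ch fits tdeg≡target = count≡⇒↭ (columns⁺ u) α λ ν → same-count ν (ν ∈? α)
      where
      same-count : ∀ ν → Dec (ν ∈ α) → count (columns⁺ u) ν ≡ count α ν
      same-count ν (no ν∉α) = ≡.trans (count-∉ (ν∉α ∘ Fits⇒columns⁺⊆α u ch fits)) (≡.sym (count-∉ ν∉α))
      same-count ν (yes ν∈α) with ∈⇒supp-index ν∈α
      ... | s , ≡.refl = ≡.trans (Fits⇒count-columns⁺ u ch fits s)
        (≡.trans (cong (λ t → Vec.lookup t s) tdeg≡target) (Vecₚ.lookup-map s (mult α) (suppV α)))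

    ↭⇒fitting-choice : ∀ u → columns⁺ u ↭ α → ∃ λ ch → Fits u ch
    ↭⇒fitting-choice u u↭α = ch , λ j → ≡.trans (proj₂ (choose j)) (cong value (≡.sym (Vecₚ.lookup∘tabulate _ j)))
      where
      choose : ∀ j → ∃ λ o → column u j ≡ value o
      choose j with positive? (column u j)
      ... | no col≯0 = nothing , ¬Positive⇒≡0Y col≯0
      ... | yes col>0 with ∈⇒supp-index (∈-resp-↭ u↭α (∈ₚ.∈-filter⁺ positive? (∈ₚ.∈-tabulate⁺ j) col>0))
      ... | s , μ≡col = just s , ≡.sym μ≡col
      ch : Vec Choice n
      ch = Vec.tabulate (proj₁ ∘ choose)

    coeff-e-↭ : ∀ u → columns⁺ u ↭ α → coeff (e α) u ≈ 1#
    coeff-e-↭ u u↭α with ↭⇒fitting-choice u u↭α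
    ... | ch₀ , fits = begin
      coeff (e α) u                       ≈⟨ coeff-e u ⟩
      ∑ (choices n) (indicator ∘ hit? u)  ≈⟨ ∑-choices-single n ch₀ misses ⟩
      indicator (hit? u ch₀)              ≈⟨ indicator-yes (hit? u ch₀) hit₀ ⟩
      1#                                  ∎
      where
      open ≈-Reasoning
      hit₀ : Hit u ch₀
      hit₀ = Fits⇒↭⇒tdeg≡target u ch₀ fits u↭α , Fits⇒monomialOf≡ ch₀ fits
      misses : ∀ ch → ch ≢ ch₀ → indicator (hit? u ch) ≈ 0#
      misses ch ch≢ch₀ = indicator-no (hit? u ch) λ (_ , mon≡u) → ch≢ch₀ (lookup-ext λ j →
        value-injective (≡.trans (≡.sym (monomialOf≡⇒Fits ch mon≡u j)) (fits j)))

    coeff-e-↭̸ : ∀ u → ¬ (columns⁺ u ↭ α) → coeff (e α) u ≈ 0#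
    coeff-e-↭̸ u u↭̸α = trans (coeff-e u) (∑-zero {xs = choices n} (All.tabulate λ {ch} _ →
      indicator-no (hit? u ch) λ (tdeg≡target , mon≡u) →
        u↭̸α (Fits⇒tdeg≡target⇒↭ u ch (monomialOf≡⇒Fits ch mon≡u) tdeg≡target)))

module Basis {c ℓ} (R : CommutativeRing c ℓ) (n m : ℕ) where
  open CommutativeRing R
  open Poly R n m
  open Coefficients R n m
  open Columns R n m
  open Multiplicity (_≟Y_ {m}) using (_↭?_; ↭-decSetoid)
  open Expansion R n m using (coeff-e-↭; coeff-e-↭̸)
  open DecMembership _≟M_ using (_∈?_)
  module ≈-Reasoning = SetoidReasoning setoid

  coeff-e-columns⁺ : ∀ {α} → All Positive α → ∀ v w → columns⁺ v ↭ columns⁺ w → coeff (e α) v ≈ coeff (e α) w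
  coeff-e-columns⁺ {α} α>0 v w v↭w with columns⁺ w ↭? α
  ... | yes w↭α = trans (coeff-e-↭ α α>0 v (↭-trans v↭w w↭α)) (sym (coeff-e-↭ α α>0 w w↭α))
  ... | no w↭̸α = trans (coeff-e-↭̸ α α>0 v (w↭̸α ∘ ↭-trans (↭-sym v↭w))) (sym (coeff-e-↭̸ α α>0 w w↭̸α))

  e-invariant : ∀ {α} → All Positive α → Invariant (e α)
  e-invariant {α} α>0 σ u =
    trans (reflexive (coeff-act σ (e α) u)) (coeff-e-columns⁺ α>0 _ u (columns⁺-actM (Perm.flip σ) u))

  e-homogeneous : ∀ {α a} → All Positive α → ∂α α ≡ a → InDegree a (e α)
  e-homogeneous {α} α>0 ∂α≡a u ∂u≢a =
    coeff-e-↭̸ α α>0 u λ u↭α → ∂u≢a (≡.trans (∂M≡∂α-columns⁺ u) (≡.trans (∂α-↭ u↭α) ∂α≡a))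

  coeff-comb-miss : ∀ cs u → All (λ t → All Positive (proj₂ t) × ¬ (columns⁺ u ↭ proj₂ t)) cs → coeff (comb cs) u ≈ 0#
  coeff-comb-miss [] u [] = refl
  coeff-comb-miss ((r , β) ∷ cs) u ((β>0 , u↭̸β) ∷ misses) = trans (coeff-comb-∷ r β cs u)
    (trans (+-cong (trans (*-congˡ (coeff-e-↭̸ β β>0 u u↭̸β)) (zeroʳ r)) (coeff-comb-miss cs u misses)) (+-identityʳ 0#))

  coeff-comb-hit : ∀ cs u {r β} → All (All Positive ∘ proj₂) cs → AllPairs (λ s t → ¬ (proj₂ s ↭ proj₂ t)) cs →
                   (r , β) ∈ cs → columns⁺ u ↭ β → coeff (comb cs) u ≈ r
  coeff-comb-hit ((r , β) ∷ cs) u (β>0 ∷ cs>0) (β↭̸cs ∷ _) (here ≡.refl) u↭β = begin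
    coeff (comb ((r , β) ∷ cs)) u              ≈⟨ coeff-comb-∷ r β cs u ⟩
    r * coeff (e β) u + coeff (comb cs) u      ≈⟨ +-cong (*-congˡ (coeff-e-↭ β β>0 u u↭β)) (coeff-comb-miss cs u misses) ⟩
    r * 1# + 0#                                ≈⟨ +-identityʳ _ ⟩
    r * 1#                                     ≈⟨ *-identityʳ r ⟩
    r                                          ∎
    where
    open ≈-Reasoning
    misses : All (λ t → All Positive (proj₂ t) × ¬ (columns⁺ u ↭ proj₂ t)) cs
    misses = All.zipWith (λ (γ>0 , β↭̸γ) → γ>0 , β↭̸γ ∘ ↭-trans (↭-sym u↭β)) (cs>0 , β↭̸cs)
  coeff-comb-hit ((r₀ , β₀) ∷ cs) u (β₀>0 ∷ cs>0) (β₀↭̸cs ∷ distinct) (there t∈cs) u↭β = begin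
    coeff (comb ((r₀ , β₀) ∷ cs)) u            ≈⟨ coeff-comb-∷ r₀ β₀ cs u ⟩
    r₀ * coeff (e β₀) u + coeff (comb cs) u    ≈⟨ +-cong (*-congˡ (coeff-e-↭̸ β₀ β₀>0 u λ u↭β₀ →
                                                          All.lookup β₀↭̸cs t∈cs (↭-trans (↭-sym u↭β₀) u↭β)))
                                                         (coeff-comb-hit cs u cs>0 distinct t∈cs u↭β) ⟩
    r₀ * 0# + _                                ≈⟨ +-congʳ (zeroʳ r₀) ⟩
    0# + _                                     ≈⟨ +-identityˡ _ ⟩
    _                                          ∎
    where open ≈-Reasoning

  independent : ∀ cs → All (Admissible n ∘ proj₂) cs → AllPairs (λ s t → ¬ (proj₂ s ↭ proj₂ t)) cs →
                comb cs ≈ₚ 0ₚ → All (λ t → proj₁ t ≈ 0#) cs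
  independent cs admissible distinct comb≈0 = All.tabulate λ {(r , β)} t∈cs →
    trans (sym (coeff-comb-hit cs (monomial β) (All.map proj₁ admissible) distinct t∈cs
                 (↭-reflexive (columns⁺-monomial (All.lookup admissible t∈cs)))))
          (comb≈0 (monomial β))

  module _ {q} {Q : YMulti m → Set q} (Q? : U.Decidable Q) (Q-resp-↭ : ∀ {β γ} → β ↭ γ → Q β → Q γ)
           (f : A) (f-invariant : Invariant f) (f-supported : ∀ u → ¬ Q (columns⁺ u) → coeff f u ≈ 0#) where

    termClasses : List (YMulti m)
    termClasses = map (columns⁺ ∘ proj₂) f

    classes : List (YMulti m)
    classes = List.filter Q? (List.deduplicate _↭?_ termClasses)

    classes-admissible : All (λ β → Admissible n β × Q β) classes
    classes-admissible = All.tabulate λ β∈ →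
      let β∈dedup , Qβ = ∈ₚ.∈-filter⁻ Q? {xs = List.deduplicate _↭?_ termClasses} β∈
          t , _ , β≡ = ∈ₚ.∈-map⁻ (columns⁺ ∘ proj₂) (∈ₚ.∈-deduplicate⁻ _↭?_ termClasses β∈dedup)
      in ≡.subst (Admissible n) (≡.sym β≡) (columns⁺-admissible (proj₂ t)) , Qβ

    classes-distinct : AllPairs (λ β γ → ¬ (β ↭ γ)) classes
    classes-distinct = AllPairsₚ.filter⁺ Q? (deduplicate-! ↭-decSetoid termClasses)

    coefficients : List (Carrier × YMulti m)
    coefficients = map (λ β → coeff f (monomial β) , β) classes

    coefficients-admissible : All (λ t → Admissible n (proj₂ t) × Q (proj₂ t)) coefficients
    coefficients-admissible = Allₚ.map⁺ classes-admissible

    coeff-f-hit : ∀ v {β} → β ∈ classes → columns⁺ v ↭ β → coeff f v ≈ coeff (comb coefficients) v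
    coeff-f-hit v {β} β∈ v↭β =
      let β-admissible = proj₁ (All.lookup classes-admissible β∈)
          σ , σβ≡v = columns⁺-↭⇒orbit {monomial β} {v} (↭-trans (↭-reflexive (columns⁺-monomial β-admissible)) (↭-sym v↭β))
      in begin
      coeff f v                         ≡⟨ cong (coeff f) σβ≡v ⟨
      coeff f (actM σ (monomial β))     ≈⟨ Invariant⇒coeff-actM f f-invariant σ (monomial β) ⟩
      coeff f (monomial β)              ≈⟨ coeff-comb-hit coefficients v coefficients-positive
                                             (AllPairsₚ.map⁺ classes-distinct) (∈ₚ.∈-map⁺ _ β∈) v↭β ⟨
      coeff (comb coefficients) v       ∎
      where
      open ≈-Reasoning
      coefficients-positive : All (All Positive ∘ proj₂) coefficients
      coefficients-positive = All.map (proj₁ ∘ proj₁) coefficients-admissible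

    columns⁺-∈ : ∀ {v} → v ∈ map proj₂ f → columns⁺ v ∈ termClasses
    columns⁺-∈ v∈f with ∈ₚ.∈-map⁻ proj₂ v∈f
    ... | t , t∈f , ≡.refl = ∈ₚ.∈-map⁺ (columns⁺ ∘ proj₂) t∈f

    class-of-term : ∀ {v} → v ∈ map proj₂ f → Any.Any (columns⁺ v ↭_) (List.deduplicate _↭?_ termClasses)
    class-of-term v∈f =
      Anyₚ.deduplicate⁺ _↭?_ (λ γ↭δ v↭γ → ↭-trans v↭γ (↭-sym γ↭δ)) (Any.map ↭-reflexive (columns⁺-∈ v∈f))

    coeff-f-miss : ∀ v → ¬ Any.Any (columns⁺ v ↭_) classes → coeff f v ≈ 0#
    coeff-f-miss v v∉classes with Q? (columns⁺ v) | v ∈? map proj₂ f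
    ... | no ¬Qv | _ = f-supported v ¬Qv
    ... | yes _ | no v∉f = coeff-∉ f v∉f
    ... | yes Qv | yes v∈f
      with Anyₚ.filter⁺ Q? (class-of-term v∈f)
    ... | inj₁ v∈classes = contradiction v∈classes v∉classes
    ... | inj₂ ¬Q = contradiction (Q-resp-↭ (Anyₚ.lookup-result (class-of-term v∈f)) Qv) ¬Q

    f≈comb : f ≈ₚ comb coefficients
    f≈comb v with Any.any? (columns⁺ v ↭?_) classes
    ... | yes hit = let β , β∈ , v↭β = find hit in coeff-f-hit v β∈ v↭β
    ... | no miss = trans (coeff-f-miss v miss) (sym (coeff-comb-miss coefficients v (Allₚ.map⁺ (All.zipWith
          (λ (((β>0 , _) , _) , v↭̸β) → β>0 , v↭̸β) (classes-admissible , Allₚ.¬Any⇒All¬ classes miss)))))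

    spanning : Σ (List (Carrier × YMulti m)) λ cs → All (λ t → Admissible n (proj₂ t) × Q (proj₂ t)) cs × f ≈ₚ comb cs
    spanning = coefficients , coefficients-admissible , f≈comb

proposition1p4 : ∀ {c ℓ} (R : CommutativeRing c ℓ) (n m : ℕ) → 1 ≤ n → 2 ≤ m →
    Poly.IsBasis R n m (Poly.Invariant R n m) (Admissible n)
    × (∀ (a : Vec ℕ m) → Poly.IsBasis R n m
         (λ f → Poly.Invariant R n m f × Poly.InDegree R n m a f)
         (λ α → Admissible n α × ∂α α ≡ a))
proposition1p4 R n m _ _ = invariants , homogeneous-invariants
  where
  open Basis R n m
  open Columns R n m using (∂M≡∂α-columns⁺; ∂α-↭)

  invariants : Poly.IsBasis R n m (Poly.Invariant R n m) (Admissible n)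
  invariants = record
    { members = λ α (α>0 , _) → e-invariant α>0
    ; independent = independent
    ; spanning = λ f f-invariant →
        let cs , ok , f≈cs = spanning (λ _ → yes tt) _ f f-invariant λ _ ¬⊤ → contradiction tt ¬⊤
        in cs , All.map proj₁ ok , f≈cs
    }

  homogeneous-invariants : ∀ a → Poly.IsBasis R n m
    (λ f → Poly.Invariant R n m f × Poly.InDegree R n m a f) (λ α → Admissible n α × ∂α α ≡ a)
  homogeneous-invariants a = record
    { members = λ α ((α>0 , _) , ∂α≡a) → e-invariant α>0 , e-homogeneous α>0 ∂α≡a
    ; independent = λ cs ok → independent cs (All.map proj₁ ok)
    ; spanning = λ f (f-invariant , f-homogeneous) →
        spanning (λ β → Vecₚ.≡-dec ℕₚ._≟_ (∂α β) a) (λ β↭γ ∂β≡a → ≡.trans (≡.sym (∂α-↭ β↭γ)) ∂β≡a)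
                 f f-invariant
                 λ u ∂u≢a → f-homogeneous u (∂u≢a ∘ ≡.trans (≡.sym (∂M≡∂α-columns⁺ u)))
    }
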